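{- Over the language $\langle\land,\lor,\Rightarrow,\neg,0,1\rangle$ (with $\Rightarrow$ interpreted in $\mathcal N3$ as the strong implication), Nelson logic $\mathcal N3$ coincides with the axiomatic strengthening of Nelson's logic $\mathcal S$ obtained by adding the axiom schema $((\varphi^2\Rightarrow\psi)\land((\neg\psi)^2\Rightarrow\neg\varphi))\Rightarrow(\varphi\Rightarrow\psi)$, where $\chi^2:=\neg(\chi\Rightarrow\neg\chi)$.
   Context: $\mathcal N4$ is the logic in the language $\langle\land,\lor,\to,\neg\rangle$ given by modus ponens for $\to$ and the axiom schemata (with $\varphi\leftrightarrow\psi:=(\varphi\to\psi)\land(\psi\to\varphi)$): (N1) $\phi\to(\psi\to\phi)$; (N2) $(\phi\to(\psi\to\gamma))\to((\phi\to\psi)\to(\phi\to\gamma))$; (N3) $(\phi\land\psi)\to\phi$; (N4) $(\phi\land\psi)\to\psi$; (N5) $(\phi\to\psi)\to((\phi\to\gamma)\to(\phi\to(\psi\land\gamma)))$; (N6) $\phi\to(\phi\lor\psi)$; (N7) $\psi\to(\phi\lor\psi)$; (N8) $(\phi\to\gamma)\to((\psi\to\gamma)\to((\phi\lor\psi)\to\gamma))$; (N9) $\neg\neg\phi\leftrightarrow\phi$; (N10) $\neg(\phi\lor\psi)\leftrightarrow(\neg\phi\land\neg\psi)$; (N11) $\neg(\phi\land\psi)\leftrightarrow(\neg\phi\lor\neg\psi)$; (N12) $\neg(\phi\to\psi)\leftrightarrow(\phi\land\neg\psi)$. Nelson logic $\mathcal N3$ is $\mathcal N4$ plus the axiom schema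 (N13) $\neg\phi\to(\phi\to\psi)$. In $\mathcal N3$ the strong implication is $\varphi\Rightarrow\psi:=(\varphi\to\psi)\land(\neg\psi\to\neg\varphi)$ and the constants are term-definable by $1:=p\to p$ (for a fixed variable $p$) and $0:=\neg1$. Nelson's logic $\mathcal S$ is the sentential logic in the language $\langle\land,\lor,\Rightarrow,\neg,0\rangle$ (with $1:=\neg0$) given by the following Hilbert-style calculus. Abbreviations: $\phi\Leftrightarrow\psi:=(\phi\Rightarrow\psi)\land(\psi\Rightarrow\phi)$, $\phi\Rightarrow^2\psi:=\phi\Rightarrow(\phi\Rightarrow\psi)$; for a finite (possibly empty) list $\Gamma=(\phi_1,\dots,\phi_n)$, $\Gamma\Rightarrow\phi:=\phi_1\Rightarrow(\phi_2\Rightarrow(\cdots(\phi_n\Rightarrow\phi)\cdots))$ and $\Gamma\Rightarrow^2\phi:=\phi_1\Rightarrow^2(\cdots(\phi_n\Rightarrow^2\phi)\cdots)$, both $\phi$ if $\Gamma$ is empty. Axioms: (A1) $\phi\Rightarrow\phi$; (A2) $0\Rightarrow\psi$; (A3) $\neg\phi\Rightarrow(\phi\Rightarrow0)$; (A4) $1$; (A5) $(\phi\Rightarrow\psi)\Leftrightarrow(\neg\psi\Rightarrow\neg\phi)$. Rules ("premisses / conclusion", for every finite list $\Gamma$): (P) $\Gamma\Rightarrow(\phi\Rightarrow(\psi\Rightarrow\gamma))$ / $\Gamma\Rightarrow(\psi\Rightarrow(\phi\Rightarrow\gamma))$; (C) $\phi\Rightarrow(\phi\Rightarrow(\phi\Rightarrow\gamma))$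 / $\phi\Rightarrow(\phi\Rightarrow\gamma)$; (E) $\Gamma\Rightarrow\phi$, $\phi\Rightarrow\gamma$ / $\Gamma\Rightarrow\gamma$; ($\Rightarrow$l) $\Gamma\Rightarrow\phi$, $\psi\Rightarrow\gamma$ / $\Gamma\Rightarrow((\phi\Rightarrow\psi)\Rightarrow\gamma)$; ($\Rightarrow$r) $\gamma$ / $\phi\Rightarrow\gamma$; ($\land$l1) $\phi\Rightarrow\gamma$ / $(\phi\land\psi)\Rightarrow\gamma$; ($\land$l2) $\psi\Rightarrow\gamma$ / $(\phi\land\psi)\Rightarrow\gamma$; ($\land$r) $\Gamma\Rightarrow\phi$, $\Gamma\Rightarrow\psi$ / $\Gamma\Rightarrow(\phi\land\psi)$; ($\lor$l1) $\phi\Rightarrow\gamma$, $\psi\Rightarrow\gamma$ / $(\phi\lor\psi)\Rightarrow\gamma$; ($\lor$l2) $\phi\Rightarrow^2\gamma$, $\psi\Rightarrow^2\gamma$ / $(\phi\lor\psi)\Rightarrow^2\gamma$; ($\lor$r1) $\Gamma\Rightarrow\phi$ / $\Gamma\Rightarrow(\phi\lor\psi)$; ($\lor$r2) $\Gamma\Rightarrow\psi$ / $\Gamma\Rightarrow(\phi\lor\psi)$; ($\neg\Rightarrow$l) $(\phi\land\neg\psi)\Rightarrow\gamma$ / $\neg(\phi\Rightarrow\psi)\Rightarrow\gamma$; ($\neg\Rightarrow$r) $\Gamma\Rightarrow^2(\phi\land\neg\psi)$ / $\Gamma\Rightarrow^2\neg(\phi\Rightarrow\psi)$; ($\neg\land$l)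 $(\neg\phi\lor\neg\psi)\Rightarrow\gamma$ / $\neg(\phi\land\psi)\Rightarrow\gamma$; ($\neg\land$r) $\Gamma\Rightarrow(\neg\phi\lor\neg\psi)$ / $\Gamma\Rightarrow\neg(\phi\land\psi)$; ($\neg\lor$l) $(\neg\phi\land\neg\psi)\Rightarrow\gamma$ / $\neg(\phi\lor\psi)\Rightarrow\gamma$; ($\neg\lor$r) $\Gamma\Rightarrow(\neg\phi\land\neg\psi)$ / $\Gamma\Rightarrow\neg(\phi\lor\psi)$; ($\neg\neg$l) $\phi\Rightarrow\gamma$ / $\neg\neg\phi\Rightarrow\gamma$; ($\neg\neg$r) $\Gamma\Rightarrow\phi$ / $\Gamma\Rightarrow\neg\neg\phi$. -}

module Defs where

open import Data.Nat using (ℕ)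
open import Data.List using (List; []; _∷_)
open import Data.Product using (Σ; _×_)
open import Relation.Binary.PropositionalEquality using (_≡_)

infixr 20 _⊃_
infixl 30 _∧ₙ_ _∨ₙ_
data NF : Set where
  nvar  : ℕ → NF
  _∧ₙ_  : NF → NF → NF
  _∨ₙ_  : NF → NF → NF
  _⊃_   : NF → NF → NF
  ¬ₙ_   : NF → NF

_↔ₙ_ : NF → NF → NF
φ ↔ₙ ψ = (φ ⊃ ψ) ∧ₙ (ψ ⊃ φ)

data N3Ax : NF → Set where
  N1  : ∀ φ ψ → N3Ax (φ ⊃ (ψ ⊃ φ))
  N2  : ∀ φ ψ γ → N3Ax ((φ ⊃ (ψ ⊃ γ)) ⊃ ((φ ⊃ ψ) ⊃ (φ ⊃ γ)))
  N3  : ∀ φ ψ → N3Ax ((φ ∧ₙ ψ) ⊃ φ)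
  N4  : ∀ φ ψ → N3Ax ((φ ∧ₙ ψ) ⊃ ψ)
  N5  : ∀ φ ψ γ → N3Ax ((φ ⊃ ψ) ⊃ ((φ ⊃ γ) ⊃ (φ ⊃ (ψ ∧ₙ γ))))
  N6  : ∀ φ ψ → N3Ax (φ ⊃ (φ ∨ₙ ψ))
  N7  : ∀ φ ψ → N3Ax (ψ ⊃ (φ ∨ₙ ψ))
  N8  : ∀ φ ψ γ → N3Ax ((φ ⊃ γ) ⊃ ((ψ ⊃ γ) ⊃ ((φ ∨ₙ ψ) ⊃ γ)))
  N9  : ∀ φ → N3Ax ((¬ₙ (¬ₙ φ)) ↔ₙ φ)
  N10 : ∀ φ ψ → N3Ax ((¬ₙ (φ ∨ₙ ψ)) ↔ₙ ((¬ₙ φ) ∧ₙ (¬ₙ ψ)))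
  N11 : ∀ φ ψ → N3Ax ((¬ₙ (φ ∧ₙ ψ)) ↔ₙ ((¬ₙ φ) ∨ₙ (¬ₙ ψ)))
  N12 : ∀ φ ψ → N3Ax ((¬ₙ (φ ⊃ ψ)) ↔ₙ (φ ∧ₙ (¬ₙ ψ)))
  N13 : ∀ φ ψ → N3Ax ((¬ₙ φ) ⊃ (φ ⊃ ψ))

data _⊢N3_ (Γ : NF → Set) : NF → Set where
  hyp : ∀ {φ} → Γ φ → Γ ⊢N3 φ
  ax  : ∀ {φ} → N3Ax φ → Γ ⊢N3 φ
  mp  : ∀ {φ ψ} → Γ ⊢N3 (φ ⊃ ψ) → Γ ⊢N3 φ → Γ ⊢N3 ψ

infixr 20 _⇒_ _⇒²_
infixl 30 _∧_ _∨_
infix 40 ~_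
infixr 15 _⇛_ _⇛²_
data SF : Set where
  var  : ℕ → SF
  _∧_  : SF → SF → SF
  _∨_  : SF → SF → SF
  _⇒_  : SF → SF → SF
  ~_   : SF → SF
  𝟘    : SF

𝟙 : SF
𝟙 = ~ 𝟘

_⇔_ : SF → SF → SF
φ ⇔ ψ = (φ ⇒ ψ) ∧ (ψ ⇒ φ)

_⇒²_ : SF → SF → SF
φ ⇒² ψ = φ ⇒ (φ ⇒ ψ)

_⇛_ : List SF → SF → SF
[] ⇛ φ = φ
(χ ∷ Γ) ⇛ φ = χ ⇒ (Γ ⇛ φ)

_⇛²_ : List SF → SF → SF
[] ⇛² φ = φ
(χ ∷ Γ) ⇛² φ = χ ⇒² (Γ ⇛² φ)

sq : SF → SF
sq χ = ~ (χ ⇒ ~ χ)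

extraAx : SF → SF → SF
extraAx φ ψ = ((sq φ ⇒ ψ) ∧ (sq (~ ψ) ⇒ ~ φ)) ⇒ (φ ⇒ ψ)

data _⊢S⁺_ (Γ : SF → Set) : SF → Set where
  hyp  : ∀ {φ} → Γ φ → Γ ⊢S⁺ φ
  A1   : ∀ φ → Γ ⊢S⁺ (φ ⇒ φ)
  A2   : ∀ ψ → Γ ⊢S⁺ (𝟘 ⇒ ψ)
  A3   : ∀ φ → Γ ⊢S⁺ (~ φ ⇒ (φ ⇒ 𝟘))
  A4   : Γ ⊢S⁺ 𝟙
  A5   : ∀ φ ψ → Γ ⊢S⁺ ((φ ⇒ ψ) ⇔ (~ ψ ⇒ ~ φ))
  Aext : ∀ φ ψ → Γ ⊢S⁺ extraAx φ ψ
  P    : ∀ Δ {φ ψ γ} → Γ ⊢S⁺ (Δ ⇛ (φ ⇒ (ψ ⇒ γ))) → Γ ⊢S⁺ (Δ ⇛ (ψ ⇒ (φ ⇒ γ)))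
  C    : ∀ {φ γ} → Γ ⊢S⁺ (φ ⇒ (φ ⇒ (φ ⇒ γ))) → Γ ⊢S⁺ (φ ⇒ (φ ⇒ γ))
  E    : ∀ Δ {φ γ} → Γ ⊢S⁺ (Δ ⇛ φ) → Γ ⊢S⁺ (φ ⇒ γ) → Γ ⊢S⁺ (Δ ⇛ γ)
  ⇒l   : ∀ Δ {φ ψ γ} → Γ ⊢S⁺ (Δ ⇛ φ) → Γ ⊢S⁺ (ψ ⇒ γ) → Γ ⊢S⁺ (Δ ⇛ ((φ ⇒ ψ) ⇒ γ))
  ⇒r   : ∀ {φ γ} → Γ ⊢S⁺ γ → Γ ⊢S⁺ (φ ⇒ γ)
  ∧l1  : ∀ {φ ψ γ} → Γ ⊢S⁺ (φ ⇒ γ) → Γ ⊢S⁺ ((φ ∧ ψ) ⇒ γ)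
  ∧l2  : ∀ {φ ψ γ} → Γ ⊢S⁺ (ψ ⇒ γ) → Γ ⊢S⁺ ((φ ∧ ψ) ⇒ γ)
  ∧r   : ∀ Δ {φ ψ} → Γ ⊢S⁺ (Δ ⇛ φ) → Γ ⊢S⁺ (Δ ⇛ ψ) → Γ ⊢S⁺ (Δ ⇛ (φ ∧ ψ))
  ∨l1  : ∀ {φ ψ γ} → Γ ⊢S⁺ (φ ⇒ γ) → Γ ⊢S⁺ (ψ ⇒ γ) → Γ ⊢S⁺ ((φ ∨ ψ) ⇒ γ)
  ∨l2  : ∀ {φ ψ γ} → Γ ⊢S⁺ (φ ⇒² γ) → Γ ⊢S⁺ (ψ ⇒² γ) → Γ ⊢S⁺ ((φ ∨ ψ) ⇒² γ)
  ∨r1  : ∀ Δ {φ ψ} → Γ ⊢S⁺ (Δ ⇛ φ) → Γ ⊢S⁺ (Δ ⇛ (φ ∨ ψ))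
  ∨r2  : ∀ Δ {φ ψ} → Γ ⊢S⁺ (Δ ⇛ ψ) → Γ ⊢S⁺ (Δ ⇛ (φ ∨ ψ))
  ¬⇒l  : ∀ {φ ψ γ} → Γ ⊢S⁺ ((φ ∧ ~ ψ) ⇒ γ) → Γ ⊢S⁺ (~ (φ ⇒ ψ) ⇒ γ)
  ¬⇒r  : ∀ Δ {φ ψ} → Γ ⊢S⁺ (Δ ⇛² (φ ∧ ~ ψ)) → Γ ⊢S⁺ (Δ ⇛² ~ (φ ⇒ ψ))
  ¬∧l  : ∀ {φ ψ γ} → Γ ⊢S⁺ ((~ φ ∨ ~ ψ) ⇒ γ) → Γ ⊢S⁺ (~ (φ ∧ ψ) ⇒ γ)
  ¬∧r  : ∀ Δ {φ ψ} → Γ ⊢S⁺ (Δ ⇛ (~ φ ∨ ~ ψ)) → Γ ⊢S⁺ (Δ ⇛ ~ (φ ∧ ψ))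
  ¬∨l  : ∀ {φ ψ γ} → Γ ⊢S⁺ ((~ φ ∧ ~ ψ) ⇒ γ) → Γ ⊢S⁺ (~ (φ ∨ ψ) ⇒ γ)
  ¬∨r  : ∀ Δ {φ ψ} → Γ ⊢S⁺ (Δ ⇛ (~ φ ∧ ~ ψ)) → Γ ⊢S⁺ (Δ ⇛ ~ (φ ∨ ψ))
  ¬¬l  : ∀ {φ γ} → Γ ⊢S⁺ (φ ⇒ γ) → Γ ⊢S⁺ (~ ~ φ ⇒ γ)
  ¬¬r  : ∀ Δ {φ} → Γ ⊢S⁺ (Δ ⇛ φ) → Γ ⊢S⁺ (Δ ⇛ ~ ~ φ)

-- Interpretation of the S-language in N3:
-- ⇒ as strong implication, 0 := ¬(p → p) with p the fixed variable 0
-- (so 1 = ¬0 ↦ ¬¬(p → p)).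

one₃ : NF
one₃ = nvar 0 ⊃ nvar 0

⟦_⟧ : SF → NF
⟦ var n ⟧ = nvar n
⟦ φ ∧ ψ ⟧ = ⟦ φ ⟧ ∧ₙ ⟦ ψ ⟧
⟦ φ ∨ ψ ⟧ = ⟦ φ ⟧ ∨ₙ ⟦ ψ ⟧
⟦ φ ⇒ ψ ⟧ = (⟦ φ ⟧ ⊃ ⟦ ψ ⟧) ∧ₙ ((¬ₙ ⟦ ψ ⟧) ⊃ (¬ₙ ⟦ φ ⟧))
⟦ ~ φ ⟧ = ¬ₙ ⟦ φ ⟧
⟦ 𝟘 ⟧ = ¬ₙ one₃

⟦_⟧ˢ : (SF → Set) → NF → Set
⟦ Γ ⟧ˢ χ = Σ SF (λ φ → Γ φ × ⟦ φ ⟧ ≡ χ)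

-- Every rule of S acting on the
-- right of a context Δ ⇛ _ is sound because its premiss strongly implies its
-- conclusion, and strong implication is monotone under a prefix c ⇒ₙ _;
-- the rules ¬⇒r and ∧r need two variants of this monotonicity.
--
-- Inside S⁺ we represent a sequent Δ ⊩ φ by the
-- formula Δ ⇒² φ and show, using the structural rules P, C and E, that it
-- obeys natural deduction; an N3-implication a → b becomes a² ⇒ b.  Hence
-- the translation toS : NF → SF sends N3-derivations to S⁺-derivations.
-- Finally the extra axiom shows χ ⇔ toS ⟦ χ ⟧ for every S-formula χ.
module Submission where

open import Defs
open import Data.List using (List; []; _∷_; _++_)
open import Data.Product using (_×_; _,_; proj₁; proj₂)
open import Relation.Binary.PropositionalEquality using (_≡_; refl; subst; sym; cong)

variable
  G : NF → Set
  a b c X Y Z : NF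

infixl 25 _▷_
data _▷_ (G : NF → Set) (a : NF) : NF → Set where
  old : ∀ {x} → G x → (G ▷ a) x
  new : (G ▷ a) a

weaken : ∀ {G H : NF → Set} → (∀ {x} → G x → H x) → G ⊢N3 X → H ⊢N3 X
weaken f (hyp h) = hyp (f h)
weaken f (ax x) = ax x
weaken f (mp d e) = mp (weaken f d) (weaken f e)

↑ : G ⊢N3 X → G ▷ a ⊢N3 X
↑ = weaken old

#0 : G ▷ a ⊢N3 a
#0 = hyp new

⊃-refl : G ⊢N3 (a ⊃ a)
⊃-refl {a = a} = mp (mp (ax (N2 a (a ⊃ a) a)) (ax (N1 a (a ⊃ a)))) (ax (N1 a a))

deduction : G ▷ a ⊢N3 b → G ⊢N3 (a ⊃ b)
deduction (hyp (old h)) = mp (ax (N1 _ _)) (hyp h)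
deduction (hyp new) = ⊃-refl
deduction (ax x) = mp (ax (N1 _ _)) (ax x)
deduction (mp d e) = mp (mp (ax (N2 _ _ _)) (deduction d)) (deduction e)

∧ₙ-intro : G ⊢N3 a → G ⊢N3 b → G ⊢N3 (a ∧ₙ b)
∧ₙ-intro {a = a} {b = b} p q =
  mp (mp (mp (ax (N5 one₃ a b)) (mp (ax (N1 a one₃)) p)) (mp (ax (N1 b one₃)) q)) ⊃-refl

∧ₙ-elim₁ : G ⊢N3 (a ∧ₙ b) → G ⊢N3 a
∧ₙ-elim₁ = mp (ax (N3 _ _))

∧ₙ-elim₂ : G ⊢N3 (a ∧ₙ b) → G ⊢N3 b
∧ₙ-elim₂ = mp (ax (N4 _ _))

∨ₙ-intro₁ : G ⊢N3 a → G ⊢N3 (a ∨ₙ b)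
∨ₙ-intro₁ = mp (ax (N6 _ _))

∨ₙ-intro₂ : G ⊢N3 b → G ⊢N3 (a ∨ₙ b)
∨ₙ-intro₂ = mp (ax (N7 _ _))

∨ₙ-elim : G ⊢N3 (a ∨ₙ b) → G ▷ a ⊢N3 c → G ▷ b ⊢N3 c → G ⊢N3 c
∨ₙ-elim d p q = mp (mp (mp (ax (N8 _ _ _)) (deduction p)) (deduction q)) d

explode : G ⊢N3 (¬ₙ a) → G ⊢N3 a → G ⊢N3 c
explode n p = mp (mp (ax (N13 _ _)) n) p

¬¬ₙ-elim : G ⊢N3 (¬ₙ (¬ₙ a)) → G ⊢N3 a
¬¬ₙ-elim = mp (∧ₙ-elim₁ (ax (N9 _)))

¬¬ₙ-intro : G ⊢N3 a → G ⊢N3 (¬ₙ (¬ₙ a))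
¬¬ₙ-intro = mp (∧ₙ-elim₂ (ax (N9 _)))

¬∨ₙ-elim : G ⊢N3 (¬ₙ (a ∨ₙ b)) → G ⊢N3 ((¬ₙ a) ∧ₙ (¬ₙ b))
¬∨ₙ-elim = mp (∧ₙ-elim₁ (ax (N10 _ _)))

¬∨ₙ-intro : G ⊢N3 ((¬ₙ a) ∧ₙ (¬ₙ b)) → G ⊢N3 (¬ₙ (a ∨ₙ b))
¬∨ₙ-intro = mp (∧ₙ-elim₂ (ax (N10 _ _)))

¬∧ₙ-elim : G ⊢N3 (¬ₙ (a ∧ₙ b)) → G ⊢N3 ((¬ₙ a) ∨ₙ (¬ₙ b))
¬∧ₙ-elim = mp (∧ₙ-elim₁ (ax (N11 _ _)))

¬∧ₙ-intro : G ⊢N3 ((¬ₙ a) ∨ₙ (¬ₙ b)) → G ⊢N3 (¬ₙ (a ∧ₙ b))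
¬∧ₙ-intro = mp (∧ₙ-elim₂ (ax (N11 _ _)))

¬⊃-elim : G ⊢N3 (¬ₙ (a ⊃ b)) → G ⊢N3 (a ∧ₙ (¬ₙ b))
¬⊃-elim = mp (∧ₙ-elim₁ (ax (N12 _ _)))

¬⊃-intro : G ⊢N3 (a ∧ₙ (¬ₙ b)) → G ⊢N3 (¬ₙ (a ⊃ b))
¬⊃-intro = mp (∧ₙ-elim₂ (ax (N12 _ _)))

-- Strong implication; ⟦ φ ⇒ ψ ⟧ is definitionally ⟦ φ ⟧ ⇒ₙ ⟦ ψ ⟧.
infixr 20 _⇒ₙ_
_⇒ₙ_ : NF → NF → NF
a ⇒ₙ b = (a ⊃ b) ∧ₙ ((¬ₙ b) ⊃ (¬ₙ a))

⇒ₙ-intro : G ▷ a ⊢N3 b → G ▷ (¬ₙ b) ⊢N3 (¬ₙ a) → G ⊢N3 (a ⇒ₙ b)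
⇒ₙ-intro p q = ∧ₙ-intro (deduction p) (deduction q)

⇒ₙ-mp : G ⊢N3 (a ⇒ₙ b) → G ⊢N3 a → G ⊢N3 b
⇒ₙ-mp s = mp (∧ₙ-elim₁ s)

⇒ₙ-mt : G ⊢N3 (a ⇒ₙ b) → G ⊢N3 (¬ₙ b) → G ⊢N3 (¬ₙ a)
⇒ₙ-mt s = mp (∧ₙ-elim₂ s)

¬⇒ₙ-elim : G ⊢N3 (¬ₙ (a ⇒ₙ b)) → G ⊢N3 (a ∧ₙ (¬ₙ b))
¬⇒ₙ-elim p = ∨ₙ-elim (¬∧ₙ-elim p)
  (¬⊃-elim #0)
  (∧ₙ-intro (¬¬ₙ-elim (∧ₙ-elim₂ (¬⊃-elim #0))) (∧ₙ-elim₁ (¬⊃-elim #0)))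

¬⇒ₙ-intro : G ⊢N3 a → G ⊢N3 (¬ₙ b) → G ⊢N3 (¬ₙ (a ⇒ₙ b))
¬⇒ₙ-intro p q = ¬∧ₙ-intro (∨ₙ-intro₁ (¬⊃-intro (∧ₙ-intro p q)))

⇒ₙ-mono : G ⊢N3 (X ⇒ₙ Y) → G ⊢N3 ((c ⇒ₙ X) ⇒ₙ (c ⇒ₙ Y))
⇒ₙ-mono s = ⇒ₙ-intro
  (⇒ₙ-intro (⇒ₙ-mp (↑ (↑ s)) (⇒ₙ-mp (↑ #0) #0)) (⇒ₙ-mt (↑ #0) (⇒ₙ-mt (↑ (↑ s)) #0)))
  (¬⇒ₙ-intro (∧ₙ-elim₁ (¬⇒ₙ-elim #0)) (⇒ₙ-mt (↑ s) (∧ₙ-elim₂ (¬⇒ₙ-elim #0))))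

⇒ₙ-under : ∀ Δ {A B} → G ⊢N3 (⟦ A ⟧ ⇒ₙ ⟦ B ⟧) → G ⊢N3 (⟦ Δ ⇛ A ⟧ ⇒ₙ ⟦ Δ ⇛ B ⟧)
⇒ₙ-under [] s = s
⇒ₙ-under (χ ∷ Δ) s = ⇒ₙ-mono (⇒ₙ-under Δ s)

rewrite-under : ∀ Δ {A B} → G ⊢N3 (⟦ A ⟧ ⇒ₙ ⟦ B ⟧) → G ⊢N3 ⟦ Δ ⇛ A ⟧ → G ⊢N3 ⟦ Δ ⇛ B ⟧
rewrite-under Δ s = ⇒ₙ-mp (⇒ₙ-under Δ s)

-- X implies Y, and X makes ¬Y imply ¬X.  This weaker relation is
-- preserved under a doubled antecedent c ⇒ₙ c ⇒ₙ _, which is what the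
-- rule ¬⇒r (stated with Γ ⇒² _) needs.
CondStrong : (NF → Set) → NF → NF → Set
CondStrong G X Y = G ⊢N3 (X ⊃ Y) × G ⊢N3 (X ⊃ ((¬ₙ Y) ⊃ (¬ₙ X)))

cond-explode : G ⊢N3 (X ⊃ ((¬ₙ Y) ⊃ (¬ₙ X))) → G ⊢N3 X → G ⊢N3 (¬ₙ Y) → G ⊢N3 Z
cond-explode w x ny = explode (mp (mp w x) ny) x

cond-mono² : CondStrong G X Y → CondStrong G (c ⇒ₙ c ⇒ₙ X) (c ⇒ₙ c ⇒ₙ Y)
cond-mono² (f , w) =
  deduction (⇒ₙ-intro
    (⇒ₙ-intro (mp (↑ (↑ (↑ f))) (apply² (↑ (↑ #0)) (↑ #0)))
              (cond-explode (↑ (↑ (↑ w))) (apply² (↑ (↑ #0)) (↑ #0)) #0))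
    (cond-explode (↑ (↑ w)) (apply² (↑ #0) (∧ₙ-elim₁ (¬⇒ₙ-elim #0))) (∧ₙ-elim₂ (¬⇒ₙ-elim #0)))) ,
  deduction (deduction (cond-explode (↑ (↑ w))
    (apply² (↑ #0) (∧ₙ-elim₁ (¬⇒ₙ-elim #0)))
    (∧ₙ-elim₂ (¬⇒ₙ-elim (∧ₙ-elim₂ (¬⇒ₙ-elim #0))))))
  where
  apply² : G ⊢N3 (c ⇒ₙ c ⇒ₙ X) → G ⊢N3 c → G ⊢N3 X
  apply² h x = ⇒ₙ-mp (⇒ₙ-mp h x) x

cond-under² : ∀ Δ {A B} → CondStrong G ⟦ A ⟧ ⟦ B ⟧ → CondStrong G ⟦ Δ ⇛² A ⟧ ⟦ Δ ⇛² B ⟧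
cond-under² [] s = s
cond-under² (χ ∷ Δ) s = cond-mono² (cond-under² Δ s)

-- X and Y jointly imply Z, and ¬Z refutes one of them; preserved under a
-- common antecedent, as needed by the two-premiss rule ∧r.
JointStrong : (NF → Set) → NF → NF → NF → Set
JointStrong G X Y Z = G ⊢N3 (X ⊃ (Y ⊃ Z)) × G ⊢N3 ((¬ₙ Z) ⊃ ((¬ₙ X) ∨ₙ (¬ₙ Y)))

joint-mono : JointStrong G X Y Z → JointStrong G (c ⇒ₙ X) (c ⇒ₙ Y) (c ⇒ₙ Z)
joint-mono (f , g) =
  deduction (deduction (⇒ₙ-intro
    (mp (mp (↑ (↑ (↑ f))) (⇒ₙ-mp (↑ (↑ #0)) #0)) (⇒ₙ-mp (↑ #0) #0))
    (∨ₙ-elim (mp (↑ (↑ (↑ g))) #0) (⇒ₙ-mt (↑ (↑ (↑ #0))) #0) (⇒ₙ-mt (↑ (↑ #0)) #0)))) ,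
  deduction (∨ₙ-elim (mp (↑ g) (∧ₙ-elim₂ (¬⇒ₙ-elim #0)))
    (∨ₙ-intro₁ (¬⇒ₙ-intro (∧ₙ-elim₁ (¬⇒ₙ-elim (↑ #0))) #0))
    (∨ₙ-intro₂ (¬⇒ₙ-intro (∧ₙ-elim₁ (¬⇒ₙ-elim (↑ #0))) #0)))

joint-under : ∀ Δ {A B C} → JointStrong G ⟦ A ⟧ ⟦ B ⟧ ⟦ C ⟧ →
              JointStrong G ⟦ Δ ⇛ A ⟧ ⟦ Δ ⇛ B ⟧ ⟦ Δ ⇛ C ⟧
joint-under [] s = s
joint-under (χ ∷ Δ) s = joint-mono (joint-under Δ s)

⇒ₙ-exchange : G ⊢N3 ((a ⇒ₙ b ⇒ₙ c) ⇒ₙ (b ⇒ₙ a ⇒ₙ c))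
⇒ₙ-exchange = ⇒ₙ-intro
  (⇒ₙ-intro (⇒ₙ-intro (⇒ₙ-mp (⇒ₙ-mp (↑ (↑ #0)) #0) (↑ #0))
                      (⇒ₙ-mt (↑ (↑ #0)) (¬⇒ₙ-intro (↑ #0) #0)))
            (⇒ₙ-mt (⇒ₙ-mp (↑ #0) (∧ₙ-elim₁ (¬⇒ₙ-elim #0))) (∧ₙ-elim₂ (¬⇒ₙ-elim #0))))
  (¬⇒ₙ-intro (∧ₙ-elim₁ (¬⇒ₙ-elim (∧ₙ-elim₂ (¬⇒ₙ-elim #0))))
             (¬⇒ₙ-intro (∧ₙ-elim₁ (¬⇒ₙ-elim #0)) (∧ₙ-elim₂ (¬⇒ₙ-elim (∧ₙ-elim₂ (¬⇒ₙ-elim #0))))))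

⇒ₙ-left : G ⊢N3 (b ⇒ₙ c) → G ⊢N3 (a ⇒ₙ ((a ⇒ₙ b) ⇒ₙ c))
⇒ₙ-left e = ⇒ₙ-intro
  (⇒ₙ-intro (⇒ₙ-mp (↑ (↑ e)) (⇒ₙ-mp #0 (↑ #0))) (¬⇒ₙ-intro (↑ #0) (⇒ₙ-mt (↑ (↑ e)) #0)))
  (⇒ₙ-mt (∧ₙ-elim₁ (¬⇒ₙ-elim #0)) (⇒ₙ-mt (↑ e) (∧ₙ-elim₂ (¬⇒ₙ-elim #0))))

∨ₙ-right₁ : G ⊢N3 (a ⇒ₙ (a ∨ₙ b))
∨ₙ-right₁ = ⇒ₙ-intro (∨ₙ-intro₁ #0) (∧ₙ-elim₁ (¬∨ₙ-elim #0))

∨ₙ-right₂ : G ⊢N3 (b ⇒ₙ (a ∨ₙ b))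
∨ₙ-right₂ = ⇒ₙ-intro (∨ₙ-intro₂ #0) (∧ₙ-elim₂ (¬∨ₙ-elim #0))

¬∧ₙ-right : G ⊢N3 (((¬ₙ a) ∨ₙ (¬ₙ b)) ⇒ₙ (¬ₙ (a ∧ₙ b)))
¬∧ₙ-right = ⇒ₙ-intro (¬∧ₙ-intro #0)
  (¬∨ₙ-intro (∧ₙ-intro (¬¬ₙ-intro (∧ₙ-elim₁ (¬¬ₙ-elim #0))) (¬¬ₙ-intro (∧ₙ-elim₂ (¬¬ₙ-elim #0)))))

¬∨ₙ-right : G ⊢N3 (((¬ₙ a) ∧ₙ (¬ₙ b)) ⇒ₙ (¬ₙ (a ∨ₙ b)))
¬∨ₙ-right = ⇒ₙ-intro (¬∨ₙ-intro #0)
  (¬∧ₙ-intro (∨ₙ-elim (¬¬ₙ-elim #0) (∨ₙ-intro₁ (¬¬ₙ-intro #0)) (∨ₙ-intro₂ (¬¬ₙ-intro #0))))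

¬¬ₙ-right : G ⊢N3 (a ⇒ₙ (¬ₙ (¬ₙ a)))
¬¬ₙ-right = ⇒ₙ-intro (¬¬ₙ-intro #0) (¬¬ₙ-elim #0)

∧ₙ-right : JointStrong G a b (a ∧ₙ b)
∧ₙ-right = deduction (deduction (∧ₙ-intro (↑ #0) #0)) , deduction (¬∧ₙ-elim #0)

¬⇒ₙ-right : CondStrong G (a ∧ₙ (¬ₙ b)) (¬ₙ (a ⇒ₙ b))
¬⇒ₙ-right = deduction (¬⇒ₙ-intro (∧ₙ-elim₁ #0) (∧ₙ-elim₂ #0)) ,
  deduction (deduction (explode (∧ₙ-elim₂ (↑ #0)) (⇒ₙ-mp (¬¬ₙ-elim #0) (∧ₙ-elim₁ (↑ #0)))))

⇒ₙ-weaken : G ⊢N3 c → G ⊢N3 (a ⇒ₙ c)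
⇒ₙ-weaken p = ⇒ₙ-intro (↑ p) (explode #0 (↑ p))

⇒ₙ-contract : G ⊢N3 (a ⇒ₙ a ⇒ₙ a ⇒ₙ c) → G ⊢N3 (a ⇒ₙ a ⇒ₙ c)
⇒ₙ-contract h = ⇒ₙ-intro (⇒ₙ-mp (⇒ₙ-mp (↑ h) #0) #0)
  (explode (∧ₙ-elim₂ (¬⇒ₙ-elim #0)) (apply³ (↑ h) (∧ₙ-elim₁ (¬⇒ₙ-elim #0))))
  where
  apply³ : G ⊢N3 (a ⇒ₙ a ⇒ₙ a ⇒ₙ c) → G ⊢N3 a → G ⊢N3 c
  apply³ f x = ⇒ₙ-mp (⇒ₙ-mp (⇒ₙ-mp f x) x) x

∧ₙ-left₁ : G ⊢N3 (a ⇒ₙ c) → G ⊢N3 ((a ∧ₙ b) ⇒ₙ c)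
∧ₙ-left₁ h = ⇒ₙ-intro (⇒ₙ-mp (↑ h) (∧ₙ-elim₁ #0)) (¬∧ₙ-intro (∨ₙ-intro₁ (⇒ₙ-mt (↑ h) #0)))

∧ₙ-left₂ : G ⊢N3 (b ⇒ₙ c) → G ⊢N3 ((a ∧ₙ b) ⇒ₙ c)
∧ₙ-left₂ h = ⇒ₙ-intro (⇒ₙ-mp (↑ h) (∧ₙ-elim₂ #0)) (¬∧ₙ-intro (∨ₙ-intro₂ (⇒ₙ-mt (↑ h) #0)))

∨ₙ-left : G ⊢N3 (a ⇒ₙ c) → G ⊢N3 (b ⇒ₙ c) → G ⊢N3 ((a ∨ₙ b) ⇒ₙ c)
∨ₙ-left h k = ⇒ₙ-intro (∨ₙ-elim #0 (⇒ₙ-mp (↑ (↑ h)) #0) (⇒ₙ-mp (↑ (↑ k)) #0))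
  (¬∨ₙ-intro (∧ₙ-intro (⇒ₙ-mt (↑ h) #0) (⇒ₙ-mt (↑ k) #0)))

∨ₙ-left² : G ⊢N3 (a ⇒ₙ a ⇒ₙ c) → G ⊢N3 (b ⇒ₙ b ⇒ₙ c) →
           G ⊢N3 ((a ∨ₙ b) ⇒ₙ (a ∨ₙ b) ⇒ₙ c)
∨ₙ-left² h k = ⇒ₙ-intro (⇒ₙ-weaken (by-cases (↑ h) (↑ k) #0))
  (explode (∧ₙ-elim₂ (¬⇒ₙ-elim #0)) (by-cases (↑ h) (↑ k) (∧ₙ-elim₁ (¬⇒ₙ-elim #0))))
  where
  by-cases : G ⊢N3 (a ⇒ₙ a ⇒ₙ c) → G ⊢N3 (b ⇒ₙ b ⇒ₙ c) → G ⊢N3 (a ∨ₙ b) → G ⊢N3 c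
  by-cases f g d = ∨ₙ-elim d (⇒ₙ-mp (⇒ₙ-mp (↑ f) #0) #0) (⇒ₙ-mp (⇒ₙ-mp (↑ g) #0) #0)

¬⇒ₙ-left : G ⊢N3 ((a ∧ₙ (¬ₙ b)) ⇒ₙ c) → G ⊢N3 ((¬ₙ (a ⇒ₙ b)) ⇒ₙ c)
¬⇒ₙ-left h = ⇒ₙ-intro (⇒ₙ-mp (↑ h) (¬⇒ₙ-elim #0))
  (¬¬ₙ-intro (∨ₙ-elim (¬∧ₙ-elim (⇒ₙ-mt (↑ h) #0))
    (∧ₙ-intro (deduction (explode (↑ #0) #0)) (deduction (↑ #0)))
    (∧ₙ-intro (deduction (¬¬ₙ-elim (↑ #0))) (deduction (explode #0 (¬¬ₙ-elim (↑ #0)))))))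

¬∧ₙ-left : G ⊢N3 (((¬ₙ a) ∨ₙ (¬ₙ b)) ⇒ₙ c) → G ⊢N3 ((¬ₙ (a ∧ₙ b)) ⇒ₙ c)
¬∧ₙ-left h = ⇒ₙ-intro (⇒ₙ-mp (↑ h) (¬∧ₙ-elim #0))
  (¬¬ₙ-intro (∧ₙ-intro (¬¬ₙ-elim (∧ₙ-elim₁ (¬∨ₙ-elim (⇒ₙ-mt (↑ h) #0))))
                       (¬¬ₙ-elim (∧ₙ-elim₂ (¬∨ₙ-elim (⇒ₙ-mt (↑ h) #0))))))

¬∨ₙ-left : G ⊢N3 (((¬ₙ a) ∧ₙ (¬ₙ b)) ⇒ₙ c) → G ⊢N3 ((¬ₙ (a ∨ₙ b)) ⇒ₙ c)
¬∨ₙ-left h = ⇒ₙ-intro (⇒ₙ-mp (↑ h) (¬∨ₙ-elim #0))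
  (¬¬ₙ-intro (∨ₙ-elim (¬∧ₙ-elim (⇒ₙ-mt (↑ h) #0)) (∨ₙ-intro₁ (¬¬ₙ-elim #0)) (∨ₙ-intro₂ (¬¬ₙ-elim #0))))

¬¬ₙ-left : G ⊢N3 (a ⇒ₙ c) → G ⊢N3 ((¬ₙ (¬ₙ a)) ⇒ₙ c)
¬¬ₙ-left h = ⇒ₙ-intro (⇒ₙ-mp (↑ h) (¬¬ₙ-elim #0)) (¬¬ₙ-intro (⇒ₙ-mt (↑ h) #0))

⇒ₙ-refl : G ⊢N3 (a ⇒ₙ a)
⇒ₙ-refl = ⇒ₙ-intro #0 #0

𝟘-initial : ∀ ψ → G ⊢N3 ⟦ 𝟘 ⇒ ψ ⟧
𝟘-initial ψ = ⇒ₙ-intro (explode #0 ⊃-refl) (¬¬ₙ-intro ⊃-refl)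

¬-explodes : ∀ φ → G ⊢N3 ⟦ ~ φ ⇒ (φ ⇒ 𝟘) ⟧
¬-explodes φ = ⇒ₙ-intro (⇒ₙ-intro (explode (↑ #0) #0) (↑ #0)) (¬¬ₙ-intro (∧ₙ-elim₁ (¬⇒ₙ-elim #0)))

contraposition : ∀ φ ψ → G ⊢N3 ⟦ (φ ⇒ ψ) ⇔ (~ ψ ⇒ ~ φ) ⟧
contraposition φ ψ = ∧ₙ-intro
  (⇒ₙ-intro (⇒ₙ-intro (⇒ₙ-mt (↑ #0) #0) (¬¬ₙ-intro (⇒ₙ-mp (↑ #0) (¬¬ₙ-elim #0))))
            (¬⇒ₙ-intro (¬¬ₙ-elim (∧ₙ-elim₂ (¬⇒ₙ-elim #0))) (∧ₙ-elim₁ (¬⇒ₙ-elim #0))))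
  (⇒ₙ-intro (⇒ₙ-intro (¬¬ₙ-elim (⇒ₙ-mt (↑ #0) (¬¬ₙ-intro #0))) (⇒ₙ-mp (↑ #0) #0))
            (¬⇒ₙ-intro (∧ₙ-elim₂ (¬⇒ₙ-elim #0)) (¬¬ₙ-intro (∧ₙ-elim₁ (¬⇒ₙ-elim #0)))))

-- χ² = ¬(χ ⇒ ¬χ) is interpreted by a formula equivalent to χ.
sq-intro : G ⊢N3 a → G ⊢N3 (¬ₙ (a ⇒ₙ (¬ₙ a)))
sq-intro p = ¬⇒ₙ-intro p (¬¬ₙ-intro p)

extra-axiom : ∀ φ ψ → G ⊢N3 ⟦ extraAx φ ψ ⟧
extra-axiom φ ψ = ⇒ₙ-intro
  (⇒ₙ-intro (⇒ₙ-mp (∧ₙ-elim₁ (↑ #0)) (sq-intro #0)) (⇒ₙ-mp (∧ₙ-elim₂ (↑ #0)) (sq-intro #0)))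
  (¬∧ₙ-intro (∨ₙ-intro₁ (¬⇒ₙ-intro (sq-intro (∧ₙ-elim₁ (¬⇒ₙ-elim #0))) (∧ₙ-elim₂ (¬⇒ₙ-elim #0)))))

sound : ∀ {Γ φ} → Γ ⊢S⁺ φ → ⟦ Γ ⟧ˢ ⊢N3 ⟦ φ ⟧
sound (hyp {φ} h) = hyp (φ , h , refl)
sound (A1 φ) = ⇒ₙ-refl
sound (A2 ψ) = 𝟘-initial ψ
sound (A3 φ) = ¬-explodes φ
sound A4 = ¬¬ₙ-intro ⊃-refl
sound (A5 φ ψ) = contraposition φ ψ
sound (Aext φ ψ) = extra-axiom φ ψ
sound (P Δ d) = rewrite-under Δ ⇒ₙ-exchange (sound d)
sound (C d) = ⇒ₙ-contract (sound d)
sound (E Δ d e) = rewrite-under Δ (sound e) (sound d)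
sound (⇒l Δ d e) = rewrite-under Δ (⇒ₙ-left (sound e)) (sound d)
sound (⇒r d) = ⇒ₙ-weaken (sound d)
sound (∧l1 d) = ∧ₙ-left₁ (sound d)
sound (∧l2 d) = ∧ₙ-left₂ (sound d)
sound (∧r Δ d e) = mp (mp (proj₁ (joint-under Δ ∧ₙ-right)) (sound d)) (sound e)
sound (∨l1 d e) = ∨ₙ-left (sound d) (sound e)
sound (∨l2 d e) = ∨ₙ-left² (sound d) (sound e)
sound (∨r1 Δ d) = rewrite-under Δ ∨ₙ-right₁ (sound d)
sound (∨r2 Δ d) = rewrite-under Δ ∨ₙ-right₂ (sound d)
sound (¬⇒l d) = ¬⇒ₙ-left (sound d)
sound (¬⇒r Δ d) = mp (proj₁ (cond-under² Δ ¬⇒ₙ-right)) (sound d)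
sound (¬∧l d) = ¬∧ₙ-left (sound d)
sound (¬∧r Δ d) = rewrite-under Δ ¬∧ₙ-right (sound d)
sound (¬∨l d) = ¬∨ₙ-left (sound d)
sound (¬∨r Δ d) = rewrite-under Δ ¬∨ₙ-right (sound d)
sound (¬¬l d) = ¬¬ₙ-left (sound d)
sound (¬¬r Δ d) = rewrite-under Δ ¬¬ₙ-right (sound d)

toS : NF → SF
toS (nvar n) = var n
toS (a ∧ₙ b) = toS a ∧ toS b
toS (a ∨ₙ b) = toS a ∨ toS b
toS (a ⊃ b) = sq (toS a) ⇒ toS b
toS (¬ₙ a) = ~ toS a

⇛-++ : ∀ Π Π' γ → (Π ++ Π') ⇛ γ ≡ Π ⇛ (Π' ⇛ γ)
⇛-++ [] Π' γ = refl
⇛-++ (x ∷ Π) Π' γ = cong (x ⇒_) (⇛-++ Π Π' γ)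

doubled : List SF → List SF
doubled [] = []
doubled (x ∷ Δ) = x ∷ x ∷ doubled Δ

⇛²-doubled : ∀ Δ γ → Δ ⇛² γ ≡ doubled Δ ⇛ γ
⇛²-doubled [] γ = refl
⇛²-doubled (x ∷ Δ) γ = cong (λ z → x ⇒ (x ⇒ z)) (⇛²-doubled Δ γ)

module SDerivations (Γ : SF → Set) where

  ⊢_ : SF → Set
  ⊢ φ = Γ ⊢S⁺ φ

  split-++ : ∀ Π Π' γ → ⊢ ((Π ++ Π') ⇛ γ) → ⊢ (Π ⇛ (Π' ⇛ γ))
  split-++ Π Π' γ = subst ⊢_ (⇛-++ Π Π' γ)

  join-++ : ∀ Π Π' γ → ⊢ (Π ⇛ (Π' ⇛ γ)) → ⊢ ((Π ++ Π') ⇛ γ)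
  join-++ Π Π' γ = subst ⊢_ (sym (⇛-++ Π Π' γ))

  move-out : ∀ Π Δ x γ → ⊢ (Π ⇛ (Δ ⇛ (x ⇒ γ))) → ⊢ (Π ⇛ (x ⇒ (Δ ⇛ γ)))
  move-out Π [] x γ h = h
  move-out Π (y ∷ Δ) x γ h =
    P Π (split-++ Π (y ∷ []) _ (move-out (Π ++ (y ∷ [])) Δ x γ (join-++ Π (y ∷ []) _ h)))

  move-in : ∀ Π Δ x γ → ⊢ (Π ⇛ (x ⇒ (Δ ⇛ γ))) → ⊢ (Π ⇛ (Δ ⇛ (x ⇒ γ)))
  move-in Π [] x γ h = h
  move-in Π (y ∷ Δ) x γ h =
    split-++ Π (y ∷ []) _ (move-in (Π ++ (y ∷ [])) Δ x γ (join-++ Π (y ∷ []) _ (P Π h)))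

  contract-at : ∀ Π y γ → ⊢ (Π ⇛ (y ⇒ (y ⇒ (y ⇒ γ)))) → ⊢ (Π ⇛ (y ⇒ (y ⇒ γ)))
  contract-at Π y γ h =
    move-in [] Π y (y ⇒ γ) (move-in (y ∷ []) Π y γ (C
      (move-out (y ∷ y ∷ []) Π y γ (move-out (y ∷ []) Π y (y ⇒ γ) (move-out [] Π y (y ⇒ (y ⇒ γ)) h)))))

  contract-block : ∀ Π Δ F → ⊢ (Π ⇛ (doubled Δ ⇛ (doubled Δ ⇛ F))) → ⊢ (Π ⇛ (doubled Δ ⇛ F))
  contract-block Π [] F h = h
  contract-block Π (y ∷ Δ) F h =
    split-++ Π yy _ (contract-block Π' Δ F (join-++ Π yy _
      (contract-at Π y D² (contract-at Π y (y ⇒ D²) (split-++ Π yy _ (split-++ Π' (y ∷ []) _ y-out))))))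
    where
    yy = y ∷ y ∷ []
    D = doubled Δ
    D² = D ⇛ (D ⇛ F)
    Π' = Π ++ yy
    -- the second copy of y, moved in front of the first copy of D
    y-out : ⊢ ((Π' ++ (y ∷ [])) ⇛ (y ⇒ D²))
    y-out = move-out (Π' ++ (y ∷ [])) D y (D ⇛ F)
      (join-++ Π' (y ∷ []) _ (move-out Π' D y (y ⇒ (D ⇛ F)) (join-++ Π yy _ h)))

  infix 4 _⊩_
  record _⊩_ (Δ : List SF) (φ : SF) : Set where
    constructor ⟨_⟩
    field internal : ⊢ (doubled Δ ⇛ φ)
  open _⊩_

  weaken-block : ∀ Δ {F} → ⊢ F → ⊢ (doubled Δ ⇛ F)
  weaken-block [] p = p
  weaken-block (x ∷ Δ) p = ⇒r (⇒r (weaken-block Δ p))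

  closed : ∀ Δ {F} → ⊢ F → Δ ⊩ F
  closed Δ p = ⟨ weaken-block Δ p ⟩

  weaken⊩ : ∀ {Δ y φ} → Δ ⊩ φ → (y ∷ Δ) ⊩ φ
  weaken⊩ ⟨ p ⟩ = ⟨ ⇒r (⇒r p) ⟩

  v₀ : ∀ {Δ x} → (x ∷ Δ) ⊩ x
  v₀ {Δ} {x} = ⟨ ⇒r (move-out [] (doubled Δ) x x (weaken-block Δ (A1 x))) ⟩

  v₁ : ∀ {Δ x y} → (y ∷ x ∷ Δ) ⊩ x
  v₁ = weaken⊩ v₀

  v₂ : ∀ {Δ x y z} → (z ∷ y ∷ x ∷ Δ) ⊩ x
  v₂ = weaken⊩ v₁

  v₃ : ∀ {Δ x y z w} → (w ∷ z ∷ y ∷ x ∷ Δ) ⊩ x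
  v₃ = weaken⊩ v₂

  ⇒-elim : ∀ {Δ x G} → Δ ⊩ (x ⇒ G) → Δ ⊩ x → Δ ⊩ G
  ⇒-elim {Δ} {x} {G} ⟨ s ⟩ ⟨ t ⟩ =
    ⟨ contract-block [] Δ G (E (doubled Δ) t (move-out [] (doubled Δ) x G s)) ⟩

  cut : ∀ {Δ A B} → ⊢ (A ⇒ B) → Δ ⊩ A → Δ ⊩ B
  cut {Δ} t ⟨ p ⟩ = ⟨ E (doubled Δ) p t ⟩

  contrapose-in : ∀ φ ψ → ⊢ ((φ ⇒ ψ) ⇒ (~ ψ ⇒ ~ φ))
  contrapose-in φ ψ = E [] (A5 φ ψ) (∧l1 (A1 _))

  contrapose-out : ∀ φ ψ → ⊢ ((~ ψ ⇒ ~ φ) ⇒ (φ ⇒ ψ))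
  contrapose-out φ ψ = E [] (A5 φ ψ) (∧l2 (A1 _))

  sq-collapse : ∀ {A γ} → ⊢ (A ⇒ (A ⇒ γ)) → ⊢ (sq A ⇒ γ)
  sq-collapse {A} {γ} h =
    E [] (¬¬r (~ γ ∷ []) (P [] (E (A ∷ []) h (contrapose-in A γ)))) (contrapose-out (sq A) γ)

  ⇒²-intro : ∀ {Δ A B} → (A ∷ Δ) ⊩ B → Δ ⊩ (sq A ⇒ B)
  ⇒²-intro {Δ} {A} {B} ⟨ h ⟩ = ⟨ move-in [] (doubled Δ) (sq A) B (sq-collapse h) ⟩

  -- ¬⇒r is stated for doubled contexts, so it applies to internal sequents.
  ¬⇒-intro : ∀ {Δ A B} → Δ ⊩ (A ∧ ~ B) → Δ ⊩ (~ (A ⇒ B))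
  ¬⇒-intro {Δ} ⟨ p ⟩ = ⟨ subst ⊢_ (⇛²-doubled Δ _) (¬⇒r Δ (subst ⊢_ (sym (⇛²-doubled Δ _)) p)) ⟩

  ∧-intro : ∀ {Δ A B} → Δ ⊩ A → Δ ⊩ B → Δ ⊩ (A ∧ B)
  ∧-intro {Δ} ⟨ p ⟩ ⟨ q ⟩ = ⟨ ∧r (doubled Δ) p q ⟩

  sq-intro⊩ : ∀ {Δ A} → Δ ⊩ A → Δ ⊩ sq A
  sq-intro⊩ {Δ} p = ¬⇒-intro (∧-intro p (cut (¬¬r (_ ∷ []) (A1 _)) p))

  ⇒²-elim : ∀ {Δ A B} → Δ ⊩ (sq A ⇒ B) → Δ ⊩ A → Δ ⊩ B
  ⇒²-elim f p = ⇒-elim f (sq-intro⊩ p)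

  ∧-elim₁ : ∀ {Δ A B} → Δ ⊩ (A ∧ B) → Δ ⊩ A
  ∧-elim₁ = cut (∧l1 (A1 _))

  ∧-elim₂ : ∀ {Δ A B} → Δ ⊩ (A ∧ B) → Δ ⊩ B
  ∧-elim₂ = cut (∧l2 (A1 _))

  ∨-intro₁ : ∀ {Δ A B} → Δ ⊩ A → Δ ⊩ (A ∨ B)
  ∨-intro₁ {Δ} ⟨ p ⟩ = ⟨ ∨r1 (doubled Δ) p ⟩

  ∨-intro₂ : ∀ {Δ A B} → Δ ⊩ B → Δ ⊩ (A ∨ B)
  ∨-intro₂ {Δ} ⟨ p ⟩ = ⟨ ∨r2 (doubled Δ) p ⟩

  -- Case analysis uses ∨l2, whose doubled antecedent matches the sequent form.
  ∨-elim : ∀ {Δ A B K} → Δ ⊩ (A ∨ B) → (A ∷ Δ) ⊩ K → (B ∷ Δ) ⊩ K → Δ ⊩ K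
  ∨-elim {Δ} {K = K} d ⟨ p ⟩ ⟨ q ⟩ =
    ⟨ contract-block [] Δ K (internal (⇒-elim (⇒-elim (closed Δ (∨l2 p q)) d) d)) ⟩

  explode⊩ : ∀ {Δ A K} → Δ ⊩ (~ A) → Δ ⊩ A → Δ ⊩ K
  explode⊩ {Δ} {A} n p = cut (A2 _) (⇒-elim (⇒-elim (closed Δ (A3 A)) n) p)

  ¬¬-out : ∀ A → ⊢ (~ ~ A ⇒ A)
  ¬¬-out A = ¬¬l (A1 A)

  ¬¬-in : ∀ A → ⊢ (A ⇒ ~ ~ A)
  ¬¬-in A = ¬¬r (A ∷ []) (A1 A)

  ¬∧-out : ∀ A B → ⊢ (~ (A ∧ B) ⇒ (~ A ∨ ~ B))
  ¬∧-out A B = ¬∧l (A1 _)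

  ¬∧-in : ∀ A B → ⊢ ((~ A ∨ ~ B) ⇒ ~ (A ∧ B))
  ¬∧-in A B = ¬∧r (_ ∷ []) (A1 _)

  ¬∨-out : ∀ A B → ⊢ (~ (A ∨ B) ⇒ (~ A ∧ ~ B))
  ¬∨-out A B = ¬∨l (A1 _)

  ¬∨-in : ∀ A B → ⊢ ((~ A ∧ ~ B) ⇒ ~ (A ∨ B))
  ¬∨-in A B = ¬∨r (_ ∷ []) (A1 _)

  ¬⇒-out : ∀ A B → ⊢ (~ (A ⇒ B) ⇒ (A ∧ ~ B))
  ¬⇒-out A B = ¬⇒l (A1 _)

  sq-out : ∀ A → ⊢ (sq A ⇒ A)
  sq-out A = ¬⇒l (∧l1 (A1 A))

  axiom-toS : ∀ {φ} → N3Ax φ → [] ⊩ toS φ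
  axiom-toS (N1 φ ψ) = ⇒²-intro (⇒²-intro v₁)
  axiom-toS (N2 φ ψ γ) = ⇒²-intro (⇒²-intro (⇒²-intro (⇒²-elim (⇒²-elim v₂ v₀) (⇒²-elim v₁ v₀))))
  axiom-toS (N3 φ ψ) = ⇒²-intro (∧-elim₁ v₀)
  axiom-toS (N4 φ ψ) = ⇒²-intro (∧-elim₂ v₀)
  axiom-toS (N5 φ ψ γ) = ⇒²-intro (⇒²-intro (⇒²-intro (∧-intro (⇒²-elim v₂ v₀) (⇒²-elim v₁ v₀))))
  axiom-toS (N6 φ ψ) = ⇒²-intro (∨-intro₁ v₀)
  axiom-toS (N7 φ ψ) = ⇒²-intro (∨-intro₂ v₀)
  axiom-toS (N8 φ ψ γ) = ⇒²-intro (⇒²-intro (⇒²-intro (∨-elim v₀ (⇒²-elim v₃ v₀) (⇒²-elim v₂ v₀))))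
  axiom-toS (N9 φ) = ∧-intro (⇒²-intro (cut (¬¬-out _) v₀)) (⇒²-intro (cut (¬¬-in _) v₀))
  axiom-toS (N10 φ ψ) = ∧-intro (⇒²-intro (cut (¬∨-out _ _) v₀)) (⇒²-intro (cut (¬∨-in _ _) v₀))
  axiom-toS (N11 φ ψ) = ∧-intro (⇒²-intro (cut (¬∧-out _ _) v₀)) (⇒²-intro (cut (¬∧-in _ _) v₀))
  axiom-toS (N12 φ ψ) =
    ∧-intro (⇒²-intro (∧-intro (cut (sq-out _) (∧-elim₁ (cut (¬⇒-out _ _) v₀)))
                                (∧-elim₂ (cut (¬⇒-out _ _) v₀))))
            (⇒²-intro (¬⇒-intro (∧-intro (sq-intro⊩ (∧-elim₁ v₀)) (∧-elim₂ v₀))))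
  axiom-toS (N13 φ ψ) = ⇒²-intro (⇒²-intro (explode⊩ v₁ v₀))

  ⇒-trans : ∀ {X Y Z} → ⊢ (X ⇒ Y) → ⊢ (Y ⇒ Z) → ⊢ (X ⇒ Z)
  ⇒-trans {X} p q = E (X ∷ []) p q

  contrapose : ∀ {X Y} → ⊢ (X ⇒ Y) → ⊢ (~ Y ⇒ ~ X)
  contrapose p = E [] p (contrapose-in _ _)

  ⇒-mono : ∀ {X X' Y Y'} → ⊢ (X' ⇒ X) → ⊢ (Y ⇒ Y') → ⊢ ((X ⇒ Y) ⇒ (X' ⇒ Y'))
  ⇒-mono {X' = X'} p q = P [] (⇒l (X' ∷ []) p q)

  extra-rule : ∀ {X Y} → (X ∷ []) ⊩ Y → (~ Y ∷ []) ⊩ (~ X) → ⊢ (X ⇒ Y)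
  extra-rule {X} {Y} p q = E [] (∧r [] (sq-collapse (internal p)) (sq-collapse (internal q))) (Aext X Y)

  round-trip : ∀ χ → ⊢ (χ ⇒ toS ⟦ χ ⟧) × ⊢ (toS ⟦ χ ⟧ ⇒ χ)
  round-trip (var n) = A1 _ , A1 _
  round-trip (χ₁ ∧ χ₂) with round-trip χ₁ | round-trip χ₂
  ... | f₁ , g₁ | f₂ , g₂ = ∧r (_ ∷ []) (∧l1 f₁) (∧l2 f₂) , ∧r (_ ∷ []) (∧l1 g₁) (∧l2 g₂)
  round-trip (χ₁ ∨ χ₂) with round-trip χ₁ | round-trip χ₂
  ... | f₁ , g₁ | f₂ , g₂ =
    ∨l1 (∨r1 (_ ∷ []) f₁) (∨r2 (_ ∷ []) f₂) , ∨l1 (∨r1 (_ ∷ []) g₁) (∨r2 (_ ∷ []) g₂)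
  round-trip (~ χ) with round-trip χ
  ... | f , g = contrapose g , contrapose f
  -- toS ⟦ 𝟘 ⟧ is ~(p² ⇒ p): it is explosive, and its negation is a theorem.
  round-trip 𝟘 = A2 _ , extra-rule
    (explode⊩ (∧-elim₂ (cut (¬⇒-out _ _) v₀)) (cut (sq-out _) (∧-elim₁ (cut (¬⇒-out _ _) v₀))))
    (cut (¬¬-in _) (closed (_ ∷ []) (internal (⇒²-intro {[]} v₀))))
  -- ⟦ φ ⇒ ψ ⟧ is translated to both halves with squared antecedents; the
  -- extra axiom is exactly what recombines them into φ ⇒ ψ.
  round-trip (φ ⇒ ψ) with round-trip φ | round-trip ψ
  ... | f₁ , g₁ | f₂ , g₂ =
    ∧r (_ ∷ []) (⇒-trans (⇒-mono g₁ f₂) (⇒-mono (sq-out _) (A1 _)))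
                (⇒-trans (⇒-trans (contrapose-in _ _) (⇒-mono (contrapose f₂) (contrapose g₁)))
                         (⇒-mono (sq-out _) (A1 _))) ,
    ⇒-trans (Aext _ _) (⇒-mono f₁ g₂)

  complete : ∀ {ψ} → ⟦ Γ ⟧ˢ ⊢N3 ψ → ⊢ toS ψ
  complete (hyp (χ , h , refl)) = E [] (hyp h) (proj₁ (round-trip χ))
  complete (ax a) = internal (axiom-toS a)
  complete (mp d e) = internal (⇒²-elim {[]} ⟨ complete d ⟩ ⟨ complete e ⟩)

proposition6p5 : (Γ : SF → Set) (φ : SF) →
    (Γ ⊢S⁺ φ → ⟦ Γ ⟧ˢ ⊢N3 ⟦ φ ⟧) × (⟦ Γ ⟧ˢ ⊢N3 ⟦ φ ⟧ → Γ ⊢S⁺ φ)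
proposition6p5 Γ φ = sound , λ d → E [] (complete d) (proj₂ (round-trip φ))
  where open SDerivations Γ
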